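{- Let $\alpha=(\alpha_1,\dots,\alpha_n)$ be a composition, let $k\ge 0$, and let $\lambda$ be a partition with $\lambda_1-k\le n$. Let $\mathcal{T}$ be a semistandard Young tableau of shape $\mathcal{S}(\lambda,\alpha;k)$ whose reading word is lattice. Then every entry in the first row of the foundation $\lambda$ of $\mathcal{T}$ lies in the set \[R_{\alpha,k}=\Big\{1+\sum_{i=1}^{j}\alpha_{n+1-i} \;:\; j=1,2,\dots,n\Big\}\cup\begin{cases}\{1\} & \text{if } k>0,\\ \emptyset & \text{if } k=0.\end{cases}\] Furthermore, in that row the value $1$ occurs at most $k$ times and every other value occurs at most once.
   Context: Diagrams are drawn in English notation (rows numbered top to bottom, columns left to right). A semistandard Young tableau (SSYT) of shape $D$ (a finite set of cells) is a filling of the cells with positive integers, weakly increasing along each row from left to right and strictly increasing down each column. Its reading word is obtained by reading each row from right to left, taking the rows from top to bottom. A word is lattice if, for every prefix and every $j\ge1$, the number of $j$'s in the prefix is at least the number of $(j+1)$'s. For a composition $\alpha=(\alpha_1,\dots,\alpha_n)$ (positive parts), $|\alpha|=\sum\alpha_i$ and $\delta_\alpha$ is the partition $(n^{\alpha_n},(n-1)^{\alpha_{n-1}},\dots,1^{\alpha_1})$ (that is, $\alpha_i$ parts equal to $i$); $\Delta_\alpha$ is the $180^\circ$ rotation of the Ferrers diagram of $\delta_\alpha$, i.e. a right-justified diagram with $\alpha_1$ rows of length $1$ at the top, then $\alpha_2$ rows of length $2$, ..., and $\alpha_n$ rows of length $n$ at the bottom. For a partition $\lambda$ and $k\ge0$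 with $\lambda_1-k\le n$, the diagram $\mathcal{S}(\lambda,\alpha;k)$ ("fat staircase with bad foundation") consists of: a copy of $\Delta_\alpha$ in rows $1,\dots,|\alpha|$, each of its rows ending in column $n+k$; and a copy of the Ferrers diagram of $\lambda$ (the foundation) in rows $|\alpha|+1,\dots,|\alpha|+\ell(\lambda)$, row $|\alpha|+j$ occupying columns $1,\dots,\lambda_j$. Thus the first row of the foundation starts one row below and $k$ columns left of the bottom-left cell of $\Delta_\alpha$. -}

module Defs where

open import Data.Nat using (ℕ; zero; suc; _+_; _∸_; _≤_; _<_; _≟_)
open import Data.Nat.Properties using ()
open import Data.List using (List; []; _∷_; _++_; map; reverse; replicate; length; take; upTo; filter)
open import Data.Nat.ListAction using (sum)
open import Data.List.Relation.Unary.All using (All)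
open import Data.List.Relation.Unary.Linked using (Linked)
open import Data.Product using (_×_; _,_; Σ; ∃-syntax)
open import Data.Sum using (_⊎_)
open import Data.Empty using (⊥)
open import Relation.Binary.PropositionalEquality using (_≡_)
open import Relation.Nullary using (¬_)

IsComposition : List ℕ → Set
IsComposition α = All (λ a → 1 ≤ a) α

IsPartition : List ℕ → Set
IsPartition λ' = All (λ a → 1 ≤ a) λ' × Linked (λ a b → b ≤ a) λ'

part1 : List ℕ → ℕ
part1 []      = 0
part1 (x ∷ _) = x

-- A diagram given row by row: the i-th entry (1-indexed) of the list
-- is (s , l) meaning row i occupies columns s, s+1, ..., s+l-1.
RowSpec : Set
RowSpec = List (ℕ × ℕ)

InRow : ℕ × ℕ → ℕ → Set
InRow (s , l) c = s ≤ c × c < s + l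

Cell : RowSpec → ℕ → ℕ → Set
Cell []       r             c = ⊥
Cell (x ∷ xs) zero          c = ⊥
Cell (x ∷ xs) (suc zero)    c = InRow x c
Cell (x ∷ xs) (suc (suc r)) c = Cell xs (suc r) c

-- Row lengths of Δ_α from top to bottom: α₁ rows of length 1, α₂ rows of length 2, ...
deltaLens : ℕ → List ℕ → List ℕ
deltaLens i []       = []
deltaLens i (a ∷ as) = replicate a i ++ deltaLens (suc i) as

-- The diagram S(λ, α; k): Δ_α in rows 1..|α| with every row ending in column n+k,
-- followed by the Ferrers diagram of λ left-justified at column 1.
fatStaircase : List ℕ → List ℕ → ℕ → RowSpec
fatStaircase λ' α k =
  map (λ L → (suc ((length α + k) ∸ L) , L)) (deltaLens 1 α)
  ++ map (λ l → (1 , l)) λ'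

-- A filling is a function (row, column) ↦ entry; only values on cells matter.
Filling : Set
Filling = ℕ → ℕ → ℕ

IsSSYT : RowSpec → Filling → Set
IsSSYT D T =
  (∀ r c → Cell D r c → 1 ≤ T r c)
  × (∀ r c c' → Cell D r c → Cell D r c' → c < c' → T r c ≤ T r c')
  × (∀ r r' c → Cell D r c → Cell D r' c → r < r' → T r c < T r' c)

range : ℕ → ℕ → List ℕ
range s l = map (s +_) (upTo l)

readFrom : Filling → ℕ → RowSpec → List ℕ
readFrom T r []             = []
readFrom T r ((s , l) ∷ xs) = map (T r) (reverse (range s l)) ++ readFrom T (suc r) xs

readingWord : RowSpec → Filling → List ℕ
readingWord D T = readFrom T 1 D

occ : ℕ → List ℕ → ℕ
occ v w = length (filter (_≟ v) w)

IsLattice : List ℕ → Set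
IsLattice w = ∀ i j → 1 ≤ j → occ (suc j) (take i w) ≤ occ j (take i w)

InR : List ℕ → ℕ → ℕ → Set
InR α k v =
  (∃[ j ] (1 ≤ j × j ≤ length α × v ≡ 1 + sum (take j (reverse α))))
  ⊎ (1 ≤ k × v ≡ 1)

-- The lattice condition forces the staircase Δ_α to be filled superstandardly: reading its rows
-- right to left, top to bottom, each entry is one more than the number of cells above it in its
-- column. Column strictness gives "at least"; an entry x larger than that would find no column of
-- height x - 1 and so no unmatched letter x - 1 before it. Hence, when the foundation is reached,
-- each letter u has occurred once per column of Δ_α of height ≥ u. With E = n + k, column c has
-- height α_{E-c+1} + … + α_n: zero for c ≤ k, then strictly increasing. An entry x ≥ 2 of the
-- first foundation row therefore needs a column of height x - 1, so x lies in R_{α,k}, and since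
-- just one column has that height, x cannot occur again to its right. An entry 1 lies below no
-- cell of Δ_α, hence in one of the first k columns.
module Submission where

open import Defs
open import Data.Nat using (ℕ; zero; suc; _+_; _∸_; _≤_; _<_; _≟_; _≤?_; _<?_; z≤n; s≤s; s≤s⁻¹)
open import Data.Nat.Properties
open import Data.Nat.ListAction using (sum)
open import Data.Nat.ListAction.Properties using (sum-↭)
open import Data.List using (List; []; _∷_; _++_; map; reverse; replicate; length; take; drop; applyUpTo; [_])
open import Data.List.Properties
  using (filter-accept; filter-reject; map-upTo; reverse-++; map-++; ++-assoc; length-++; length-map; length-replicate;
         ++-identityʳ; unfold-reverse; length-filter; filter-none; take-all; drop-all; length-reverse)
open import Data.List.Relation.Binary.Permutation.Propositional.Properties using (↭-reverse)
open import Data.List.Relation.Unary.All using (All; []; _∷_)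
import Data.List.Relation.Unary.All as All
open import Data.List.Relation.Unary.All.Properties using (++⁺; replicate⁺; map⁺)
open import Data.List.Relation.Unary.Linked using (Linked; []; [-]; _∷_)
open import Data.Product using (_×_; _,_; ∃-syntax; proj₁; proj₂)
open import Data.Sum using (inj₁; inj₂)
open import Data.Empty using (⊥; ⊥-elim)
open import Relation.Binary.Definitions using (tri<; tri≈; tri>)
open import Relation.Binary.PropositionalEquality hiding ([_])
open import Relation.Nullary using (¬_; Dec; yes; no)
open import Function using (_∘_)
open import Algebra.Properties.CommutativeSemigroup +-commutativeSemigroup using (interchange)

indicator : ∀ {P : Set} → Dec P → ℕ
indicator (yes _) = 1
indicator (no _)  = 0

indicator-yes : ∀ {P : Set} (d : Dec P) → P → indicator d ≡ 1
indicator-yes (yes _) _ = refl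
indicator-yes (no ¬p) p = ⊥-elim (¬p p)

indicator-no : ∀ {P : Set} (d : Dec P) → ¬ P → indicator d ≡ 0
indicator-no (yes p) ¬p = ⊥-elim (¬p p)
indicator-no (no _)  _  = refl

indicator-cong : ∀ {P Q : Set} → (P → Q) → (Q → P) → (d : Dec P) (d′ : Dec Q) → indicator d ≡ indicator d′
indicator-cong f g (yes p) d′ = sym (indicator-yes d′ (f p))
indicator-cong f g (no ¬p) d′ = sym (indicator-no d′ (λ q → ¬p (g q)))

indicator-≤-split : ∀ v x → indicator (v ≤? x) ≡ indicator (suc v ≤? x) + indicator (x ≟ v)
indicator-≤-split v x with <-cmp v x
... | tri< v<x _ _ = trans (indicator-yes (v ≤? x) (<⇒≤ v<x))
  (sym (cong₂ _+_ (indicator-yes (suc v ≤? x) v<x) (indicator-no (x ≟ v) (>⇒≢ v<x))))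
... | tri≈ _ refl _ = trans (indicator-yes (v ≤? v) ≤-refl)
  (sym (cong₂ _+_ (indicator-no (suc v ≤? v) (n≮n v)) (indicator-yes (v ≟ v) refl)))
... | tri> _ _ x<v = trans (indicator-no (v ≤? x) (<⇒≱ x<v))
  (sym (cong₂ _+_ (indicator-no (suc v ≤? x) (<⇒≱ (<-trans x<v (n<1+n v)))) (indicator-no (x ≟ v) (<⇒≢ x<v))))

upFrom : ℕ → ℕ → List ℕ
upFrom s zero    = []
upFrom s (suc l) = s ∷ upFrom (suc s) l

applyUpTo≡upFrom : ∀ (f : ℕ → ℕ) s l → (∀ i → f i ≡ s + i) → applyUpTo f l ≡ upFrom s l
applyUpTo≡upFrom f s zero    f≡ = refl
applyUpTo≡upFrom f s (suc l) f≡ = cong₂ _∷_ (trans (f≡ 0) (+-identityʳ s))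
  (applyUpTo≡upFrom (f ∘ suc) (suc s) l (λ i → trans (f≡ (suc i)) (+-suc s i)))

range≡upFrom : ∀ s l → range s l ≡ upFrom s l
range≡upFrom s l = trans (map-upTo (s +_) l) (applyUpTo≡upFrom (s +_) s l (λ _ → refl))

length-upFrom : ∀ s l → length (upFrom s l) ≡ l
length-upFrom s zero    = refl
length-upFrom s (suc l) = cong suc (length-upFrom (suc s) l)

upFrom-snoc : ∀ s l → upFrom s (suc l) ≡ upFrom s l ++ [ s + l ]
upFrom-snoc s zero    = cong [_] (sym (+-identityʳ s))
upFrom-snoc s (suc l) = cong (s ∷_) (trans (upFrom-snoc (suc s) l) (cong (λ z → upFrom (suc s) l ++ [ z ]) (sym (+-suc s l))))

reverse-upFrom-suc : ∀ s l → reverse (upFrom s (suc l)) ≡ (s + l) ∷ reverse (upFrom s l)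
reverse-upFrom-suc s l = trans (cong reverse (upFrom-snoc s l)) (reverse-++ (upFrom s l) [ s + l ])

All-upFrom : ∀ {P : ℕ → Set} a d → (∀ c → a ≤ c → c < a + d → P c) → All P (upFrom a d)
All-upFrom a zero    _ = []
All-upFrom a (suc d) p = p a ≤-refl (m<m+n a (s≤s z≤n))
  ∷ All-upFrom (suc a) d (λ c a<c c<a+1+d → p c (<⇒≤ a<c) (subst (c <_) (sym (+-suc a d)) c<a+1+d))

occ-∷ : ∀ v x xs → occ v (x ∷ xs) ≡ indicator (x ≟ v) + occ v xs
occ-∷ v x xs with x ≟ v
... | yes x≡v = cong length (filter-accept (_≟ v) {x} {xs} x≡v)
... | no  x≢v = cong length (filter-reject (_≟ v) {x} {xs} x≢v)

occ-++ : ∀ v xs ys → occ v (xs ++ ys) ≡ occ v xs + occ v ys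
occ-++ v [] ys       = refl
occ-++ v (x ∷ xs) ys = begin
  occ v (x ∷ xs ++ ys)                ≡⟨ occ-∷ v x (xs ++ ys) ⟩
  indicator (x ≟ v) + occ v (xs ++ ys) ≡⟨ cong (indicator (x ≟ v) +_) (occ-++ v xs ys) ⟩
  indicator (x ≟ v) + (occ v xs + occ v ys) ≡⟨ +-assoc (indicator (x ≟ v)) _ _ ⟨
  indicator (x ≟ v) + occ v xs + occ v ys ≡⟨ cong (_+ occ v ys) (occ-∷ v x xs) ⟨
  occ v (x ∷ xs) + occ v ys           ∎
  where open ≡-Reasoning

occ-snoc : ∀ v xs x → occ v (xs ++ [ x ]) ≡ occ v xs + indicator (x ≟ v)
occ-snoc v xs x = trans (occ-++ v xs [ x ]) (cong (occ v xs +_) (trans (occ-∷ v x []) (+-identityʳ _)))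

occ≤length : ∀ v xs → occ v xs ≤ length xs
occ≤length v = length-filter (_≟ v)

occ-absent : ∀ v xs → All (_≢ v) xs → occ v xs ≡ 0
occ-absent v xs absent = cong length (filter-none (_≟ v) absent)

occ-snoc-shift : ∀ u p x a seg → occ u p ≡ a + occ u seg → occ u (p ++ [ x ]) ≡ a + occ u (x ∷ seg)
occ-snoc-shift u p x a seg p≡ = begin
  occ u (p ++ [ x ])                ≡⟨ occ-snoc u p x ⟩
  occ u p + indicator (x ≟ u)       ≡⟨ cong (_+ indicator (x ≟ u)) p≡ ⟩
  a + occ u seg + indicator (x ≟ u) ≡⟨ +-assoc a _ _ ⟩
  a + (occ u seg + indicator (x ≟ u)) ≡⟨ cong (a +_) (trans (+-comm (occ u seg) _) (sym (occ-∷ u x seg))) ⟩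
  a + occ u (x ∷ seg)               ∎
  where open ≡-Reasoning

occ-∷-atMostOnce : ∀ w x xs → (∀ v → v ≢ w → occ v xs ≤ 1) → (x ≢ w → occ x xs ≡ 0)
  → ∀ v → v ≢ w → occ v (x ∷ xs) ≤ 1
occ-∷-atMostOnce w x xs once fresh v v≢w = subst (_≤ 1) (sym (occ-∷ v x xs)) (head-counted (x ≟ v))
  where
  head-counted : (d : Dec (x ≡ v)) → indicator d + occ v xs ≤ 1
  head-counted (yes refl) = ≤-reflexive (cong suc (fresh v≢w))
  head-counted (no _)     = once v v≢w

occ-map-upFrom≤ : ∀ (f : ℕ → ℕ) v m b → (∀ c → c ≤ b → f c ≡ v → c ≤ m) → occ v (map f (upFrom 1 b)) ≤ m
occ-map-upFrom≤ f v m zero    _      = z≤n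
occ-map-upFrom≤ f v m (suc b) bounds = begin
  occ v (map f (upFrom 1 (suc b)))
    ≡⟨ cong (occ v) (trans (cong (map f) (upFrom-snoc 1 b)) (map-++ f (upFrom 1 b) [ suc b ])) ⟩
  occ v (map f (upFrom 1 b) ++ [ f (suc b) ])         ≡⟨ occ-snoc v (map f (upFrom 1 b)) (f (suc b)) ⟩
  occ v (map f (upFrom 1 b)) + indicator (f (suc b) ≟ v) ≤⟨ lastColumn (f (suc b) ≟ v) ⟩
  m                                                   ∎
  where
  open ≤-Reasoning
  lastColumn : (d : Dec (f (suc b) ≡ v)) → occ v (map f (upFrom 1 b)) + indicator d ≤ m
  lastColumn (yes fb≡v) = begin
    occ v (map f (upFrom 1 b)) + 1 ≤⟨ +-monoˡ-≤ 1 (occ≤length v (map f (upFrom 1 b))) ⟩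
    length (map f (upFrom 1 b)) + 1 ≡⟨ cong (_+ 1) (trans (length-map f (upFrom 1 b)) (length-upFrom 1 b)) ⟩
    b + 1                          ≡⟨ +-comm b 1 ⟩
    suc b                          ≤⟨ bounds (suc b) ≤-refl fb≡v ⟩
    m                              ∎
  lastColumn (no _) = begin
    occ v (map f (upFrom 1 b)) + 0 ≡⟨ +-identityʳ _ ⟩
    occ v (map f (upFrom 1 b))     ≤⟨ occ-map-upFrom≤ f v m b (λ c c≤b → bounds c (m≤n⇒m≤1+n c≤b)) ⟩
    m                              ∎

-- A height function g stands for the filling whose column c is 1, 2, …, g c; then
-- columns≥ g u m is the number of letters u in its columns 1, …, m.
columns≥ : (ℕ → ℕ) → ℕ → ℕ → ℕ
columns≥ g u zero    = 0
columns≥ g u (suc m) = indicator (u ≤? g (suc m)) + columns≥ g u m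

columns≡ : (ℕ → ℕ) → ℕ → ℕ → ℕ
columns≡ g v zero    = 0
columns≡ g v (suc m) = indicator (g (suc m) ≟ v) + columns≡ g v m

columns≥-split : ∀ g v m → columns≥ g v m ≡ columns≥ g (suc v) m + columns≡ g v m
columns≥-split g v zero    = refl
columns≥-split g v (suc m) = begin
  indicator (v ≤? x) + columns≥ g v m
    ≡⟨ cong₂ _+_ (indicator-≤-split v x) (columns≥-split g v m) ⟩
  (indicator (suc v ≤? x) + indicator (x ≟ v)) + (columns≥ g (suc v) m + columns≡ g v m)
    ≡⟨ interchange (indicator (suc v ≤? x)) _ _ _ ⟩
  (indicator (suc v ≤? x) + columns≥ g (suc v) m) + (indicator (x ≟ v) + columns≡ g v m) ∎
  where
  open ≡-Reasoning
  x : ℕ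
  x = g (suc m)

columns≡-absent : ∀ g v m → (∀ c → 1 ≤ c → c ≤ m → g c ≢ v) → columns≡ g v m ≡ 0
columns≡-absent g v zero    absent = refl
columns≡-absent g v (suc m) absent = cong₂ _+_
  (indicator-no (g (suc m) ≟ v) (absent (suc m) (s≤s z≤n) ≤-refl))
  (columns≡-absent g v m (λ c 1≤c c≤m → absent c 1≤c (m≤n⇒m≤1+n c≤m)))

columns≡-witness : ∀ g v m → 1 ≤ columns≡ g v m → ∃[ c ] (1 ≤ c × c ≤ m × g c ≡ v)
columns≡-witness g v (suc m) pos with g (suc m) ≟ v
... | yes gm≡v = suc m , s≤s z≤n , ≤-refl , gm≡v
... | no  _ with columns≡-witness g v m pos
...   | c , 1≤c , c≤m , gc≡v = c , 1≤c , m≤n⇒m≤1+n c≤m , gc≡v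

columns≡-atMostOne : ∀ g v m → (∀ c c′ → 1 ≤ c → c ≤ m → 1 ≤ c′ → c′ ≤ m → g c ≡ v → g c′ ≡ v → c ≡ c′)
  → columns≡ g v m ≤ 1
columns≡-atMostOne g v zero    inj = z≤n
columns≡-atMostOne g v (suc m) inj with g (suc m) ≟ v
... | yes gm≡v = ≤-reflexive (cong suc (columns≡-absent g v m
      (λ c 1≤c c≤m gc≡v → <⇒≢ (s≤s c≤m) (inj c (suc m) 1≤c (m≤n⇒m≤1+n c≤m) (s≤s z≤n) ≤-refl gc≡v gm≡v))))
... | no  _ = columns≡-atMostOne g v m
      (λ c c′ 1≤c c≤m 1≤c′ c′≤m → inj c c′ 1≤c (m≤n⇒m≤1+n c≤m) 1≤c′ (m≤n⇒m≤1+n c′≤m))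

columns≥-cong : ∀ g h u m → (∀ c → 1 ≤ c → c ≤ m → g c ≡ h c) → columns≥ g u m ≡ columns≥ h u m
columns≥-cong g h u zero    eq = refl
columns≥-cong g h u (suc m) eq = cong₂ _+_
  (cong (λ z → indicator (u ≤? z)) (eq (suc m) (s≤s z≤n) ≤-refl))
  (columns≥-cong g h u m (λ c 1≤c c≤m → eq c 1≤c (m≤n⇒m≤1+n c≤m)))

columns≥-zero-heights : ∀ u m → 1 ≤ u → columns≥ (λ _ → 0) u m ≡ 0
columns≥-zero-heights u       zero    _ = refl
columns≥-zero-heights (suc u) (suc m) p = columns≥-zero-heights (suc u) m p

columns≥-grow : ∀ g h u m c₀ → 1 ≤ c₀ → c₀ ≤ m → h c₀ ≡ suc (g c₀) → (∀ c → c ≢ c₀ → h c ≡ g c)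
  → columns≥ h u m ≡ columns≥ g u m + indicator (suc (g c₀) ≟ u)
columns≥-grow g h u zero    zero    () _ _ _
columns≥-grow g h u (suc m) c₀ 1≤c₀ c₀≤m hc₀ others with suc m ≟ c₀
... | yes refl = begin
  indicator (u ≤? h (suc m)) + columns≥ h u m
    ≡⟨ cong₂ _+_ (cong (λ z → indicator (u ≤? z)) hc₀) (columns≥-cong h g u m (λ c _ c≤m → others c (<⇒≢ (s≤s c≤m)))) ⟩
  indicator (u ≤? suc (g (suc m))) + columns≥ g u m
    ≡⟨ cong (_+ columns≥ g u m) (grow (g (suc m))) ⟩
  (indicator (u ≤? g (suc m)) + indicator (suc (g (suc m)) ≟ u)) + columns≥ g u m
    ≡⟨ +-assoc (indicator (u ≤? g (suc m))) _ _ ⟩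
  indicator (u ≤? g (suc m)) + (indicator (suc (g (suc m)) ≟ u) + columns≥ g u m)
    ≡⟨ cong (indicator (u ≤? g (suc m)) +_) (+-comm _ (columns≥ g u m)) ⟩
  indicator (u ≤? g (suc m)) + (columns≥ g u m + indicator (suc (g (suc m)) ≟ u))
    ≡⟨ +-assoc (indicator (u ≤? g (suc m))) _ _ ⟨
  indicator (u ≤? g (suc m)) + columns≥ g u m + indicator (suc (g (suc m)) ≟ u) ∎
  where
  open ≡-Reasoning
  grow : ∀ x → indicator (u ≤? suc x) ≡ indicator (u ≤? x) + indicator (suc x ≟ u)
  grow x = trans (indicator-≤-split u (suc x)) (cong (_+ indicator (suc x ≟ u)) (indicator-cong s≤s⁻¹ s≤s (suc u ≤? suc x) (u ≤? x)))
... | no m+1≢c₀ = begin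
  indicator (u ≤? h (suc m)) + columns≥ h u m
    ≡⟨ cong₂ _+_ (cong (λ z → indicator (u ≤? z)) (others (suc m) m+1≢c₀))
                 (columns≥-grow g h u m c₀ 1≤c₀ (s≤s⁻¹ (≤∧≢⇒< c₀≤m (m+1≢c₀ ∘ sym))) hc₀ others) ⟩
  indicator (u ≤? g (suc m)) + (columns≥ g u m + indicator (suc (g c₀) ≟ u))
    ≡⟨ +-assoc (indicator (u ≤? g (suc m))) _ _ ⟨
  indicator (u ≤? g (suc m)) + columns≥ g u m + indicator (suc (g c₀) ≟ u) ∎
  where open ≡-Reasoning

take-++-∷ : ∀ (p : List ℕ) x q → take (suc (length p)) (p ++ x ∷ q) ≡ p ++ [ x ]
take-++-∷ []      x q = refl
take-++-∷ (y ∷ p) x q = cong (y ∷_) (take-++-∷ p x q)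

lattice-snoc : ∀ {w} → IsLattice w → ∀ p x q → w ≡ p ++ x ∷ q
  → ∀ j → 1 ≤ j → occ (suc j) (p ++ [ x ]) ≤ occ j (p ++ [ x ])
lattice-snoc lat p x q refl j 1≤j = subst (λ z → occ (suc j) z ≤ occ j z) (take-++-∷ p x q) (lat (suc (length p)) j 1≤j)

lattice-predecessor : ∀ {w} → IsLattice w → ∀ p y q → w ≡ p ++ suc (suc y) ∷ q
  → ∀ g m s → (∀ u → 1 ≤ u → occ u p ≡ columns≥ g u m + occ u s) → occ (suc y) s ≡ 0
  → suc (occ (suc (suc y)) s) ≤ columns≡ g (suc y) m
lattice-predecessor lat p y q w≡ g m s content s-free = +-cancelˡ-≤ C (suc o) e (begin
  C + suc o                            ≡⟨ +-suc C o ⟩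
  suc (C + o)                          ≡⟨ cong suc (content x (s≤s z≤n)) ⟨
  suc (occ x p)                        ≡⟨ +-comm 1 (occ x p) ⟩
  occ x p + 1                          ≡⟨ cong (occ x p +_) (indicator-yes (x ≟ x) refl) ⟨
  occ x p + indicator (x ≟ x)          ≡⟨ occ-snoc x p x ⟨
  occ x (p ++ [ x ])                   ≤⟨ lattice-snoc lat p x q w≡ (suc y) (s≤s z≤n) ⟩
  occ (suc y) (p ++ [ x ])             ≡⟨ occ-snoc (suc y) p x ⟩
  occ (suc y) p + indicator (x ≟ suc y) ≡⟨ cong₂ _+_ (content (suc y) (s≤s z≤n)) (indicator-no (x ≟ suc y) (1+n≢n)) ⟩
  columns≥ g (suc y) m + occ (suc y) s + 0 ≡⟨ cong (λ z → z + 0) (cong₂ _+_ (columns≥-split g (suc y) m) s-free) ⟩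
  C + e + 0 + 0                        ≡⟨ trans (+-identityʳ _) (+-identityʳ _) ⟩
  C + e                                ∎)
  where
  open ≤-Reasoning
  x C e o : ℕ
  x = suc (suc y)
  C = columns≥ g x m
  e = columns≡ g (suc y) m
  o = occ x s

count≥ : ℕ → List ℕ → ℕ
count≥ t []       = 0
count≥ t (x ∷ xs) = indicator (t ≤? x) + count≥ t xs

count≥-++ : ∀ t xs ys → count≥ t (xs ++ ys) ≡ count≥ t xs + count≥ t ys
count≥-++ t []       ys = refl
count≥-++ t (x ∷ xs) ys = trans (cong (indicator (t ≤? x) +_) (count≥-++ t xs ys)) (sym (+-assoc (indicator (t ≤? x)) _ _))

count≥-replicate-below : ∀ t a i → i < t → count≥ t (replicate a i) ≡ 0
count≥-replicate-below t zero    i i<t = refl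
count≥-replicate-below t (suc a) i i<t = cong₂ _+_ (indicator-no (t ≤? i) (<⇒≱ i<t)) (count≥-replicate-below t a i i<t)

count≥-all : ∀ t xs → All (t ≤_) xs → count≥ t xs ≡ length xs
count≥-all t []       []         = refl
count≥-all t (x ∷ xs) (t≤x ∷ ps) = cong₂ _+_ (indicator-yes (t ≤? x) t≤x) (count≥-all t xs ps)

count≥-antitone : ∀ t t′ xs → t ≤ t′ → count≥ t′ xs ≤ count≥ t xs
count≥-antitone t t′ []       t≤t′ = z≤n
count≥-antitone t t′ (x ∷ xs) t≤t′ with t′ ≤? x | t ≤? x
... | yes _    | yes _   = s≤s (count≥-antitone t t′ xs t≤t′)
... | yes t′≤x | no t≰x  = ⊥-elim (t≰x (≤-trans t≤t′ t′≤x))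
... | no _     | yes _   = m≤n⇒m≤1+n (count≥-antitone t t′ xs t≤t′)
... | no _     | no _    = count≥-antitone t t′ xs t≤t′

deltaLens-≥ : ∀ j i as → j ≤ i → All (j ≤_) (deltaLens i as)
deltaLens-≥ j i []       j≤i = []
deltaLens-≥ j i (a ∷ as) j≤i = ++⁺ (replicate⁺ a j≤i) (deltaLens-≥ j (suc i) as (m≤n⇒m≤1+n j≤i))

length-deltaLens : ∀ i as → length (deltaLens i as) ≡ sum as
length-deltaLens i []       = refl
length-deltaLens i (a ∷ as) = trans (length-++ (replicate a i)) (cong₂ _+_ (length-replicate a) (length-deltaLens (suc i) as))

deltaLens-bounded : ∀ i as → All (_< i + length as) (deltaLens i as)
deltaLens-bounded i []       = []
deltaLens-bounded i (a ∷ as) = ++⁺ (replicate⁺ a (m<m+n i (s≤s z≤n)))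
  (All.map (λ {L} L<i+1+n → subst (L <_) (sym (+-suc i (length as))) L<i+1+n) (deltaLens-bounded (suc i) as))

deltaLens-sorted : ∀ b i as → b ≤ i → Linked _≤_ (b ∷ deltaLens i as)
deltaLens-sorted b i []           b≤i = [-]
deltaLens-sorted b i (zero ∷ as)  b≤i = deltaLens-sorted b (suc i) as (m≤n⇒m≤1+n b≤i)
deltaLens-sorted b i (suc a ∷ as) b≤i = b≤i ∷ block a
  where
  block : ∀ a → Linked _≤_ (i ∷ replicate a i ++ deltaLens (suc i) as)
  block zero    = deltaLens-sorted i (suc i) as (n≤1+n i)
  block (suc a) = ≤-refl ∷ block a

-- Rows of lengths i, i+1, … come in blocks of sizes a₁, a₂, …; those of length ≥ i + d are the last blocks.
count≥-deltaLens : ∀ i d as → count≥ (i + d) (deltaLens i as) ≡ sum (drop d as)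
count≥-deltaLens i d       []       = cong sum (sym (drop-all d [] z≤n))
count≥-deltaLens i zero    (a ∷ as) = begin
  count≥ (i + 0) (deltaLens i (a ∷ as)) ≡⟨ count≥-all (i + 0) _ (deltaLens-≥ (i + 0) i (a ∷ as) (≤-reflexive (+-identityʳ i))) ⟩
  length (deltaLens i (a ∷ as))         ≡⟨ length-deltaLens i (a ∷ as) ⟩
  a + sum as                            ∎
  where open ≡-Reasoning
count≥-deltaLens i (suc d) (a ∷ as) = begin
  count≥ (i + suc d) (replicate a i ++ deltaLens (suc i) as)
    ≡⟨ count≥-++ (i + suc d) (replicate a i) _ ⟩
  count≥ (i + suc d) (replicate a i) + count≥ (i + suc d) (deltaLens (suc i) as)
    ≡⟨ cong₂ _+_ (count≥-replicate-below _ a i (m<m+n i (s≤s z≤n))) (cong (λ z → count≥ z (deltaLens (suc i) as)) (+-suc i d)) ⟩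
  count≥ (suc i + d) (deltaLens (suc i) as)
    ≡⟨ count≥-deltaLens (suc i) d as ⟩
  sum (drop d as) ∎
  where open ≡-Reasoning

sum-drop-antitone : ∀ (xs : List ℕ) d d′ → d ≤ d′ → sum (drop d′ xs) ≤ sum (drop d xs)
sum-drop-antitone []       d       d′       _          = ≤-reflexive (cong sum (trans (drop-all d′ [] z≤n) (sym (drop-all d [] z≤n))))
sum-drop-antitone (x ∷ xs) zero    zero     _          = ≤-refl
sum-drop-antitone (x ∷ xs) zero    (suc d′) _          = ≤-trans (sum-drop-antitone xs zero d′ z≤n) (m≤n+m (sum xs) x)
sum-drop-antitone (x ∷ xs) (suc d) (suc d′) (s≤s d≤d′) = sum-drop-antitone xs d d′ d≤d′

sum-drop-suc< : ∀ (xs : List ℕ) d → IsComposition xs → d < length xs → sum (drop (suc d) xs) < sum (drop d xs)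
sum-drop-suc< (x ∷ xs) zero    (1≤x ∷ _)  _         = +-monoˡ-≤ (sum xs) 1≤x
sum-drop-suc< (x ∷ xs) (suc d) (_ ∷ comp) (s≤s d<n) = sum-drop-suc< xs d comp d<n

sum-drop-positive⇒< : ∀ (xs : List ℕ) d → 1 ≤ sum (drop d xs) → d < length xs
sum-drop-positive⇒< xs d pos with d <? length xs
... | yes d<n = d<n
... | no  d≮n = ⊥-elim (1+n≰n (subst (1 ≤_) (cong sum (drop-all d xs (≮⇒≥ d≮n))) pos))

take-++-≤ : ∀ j (ys zs : List ℕ) → j ≤ length ys → take j (ys ++ zs) ≡ take j ys
take-++-≤ zero    ys       zs _         = refl
take-++-≤ (suc j) (y ∷ ys) zs (s≤s j≤n) = cong (y ∷_) (take-++-≤ j ys zs j≤n)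

sum-take-reverse : ∀ (xs : List ℕ) j → j ≤ length xs → sum (take j (reverse xs)) ≡ sum (drop (length xs ∸ j) xs)
sum-take-reverse []       zero _   = refl
sum-take-reverse (x ∷ xs) j    j≤n with m≤n⇒m<n∨m≡n j≤n
... | inj₁ (s≤s j≤m) = begin
  sum (take j (reverse (x ∷ xs)))       ≡⟨ cong (λ z → sum (take j z)) (unfold-reverse x xs) ⟩
  sum (take j (reverse xs ++ [ x ]))    ≡⟨ cong sum (take-++-≤ j (reverse xs) [ x ] (subst (j ≤_) (sym (length-reverse xs)) j≤m)) ⟩
  sum (take j (reverse xs))             ≡⟨ sum-take-reverse xs j j≤m ⟩
  sum (drop (length xs ∸ j) xs)         ≡⟨ cong (λ z → sum (drop z (x ∷ xs))) (+-∸-assoc 1 j≤m) ⟨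
  sum (drop (suc (length xs) ∸ j) (x ∷ xs)) ∎
  where open ≡-Reasoning
... | inj₂ refl = begin
  sum (take (suc (length xs)) (reverse (x ∷ xs))) ≡⟨ cong sum (take-all _ (reverse (x ∷ xs)) (≤-reflexive (length-reverse (x ∷ xs)))) ⟩
  sum (reverse (x ∷ xs))                          ≡⟨ sum-↭ (↭-reverse (x ∷ xs)) ⟩
  sum (x ∷ xs)                                    ≡⟨ cong (λ z → sum (drop z (x ∷ xs))) (n∸n≡0 (length xs)) ⟨
  sum (drop (length xs ∸ length xs) (x ∷ xs))     ∎
  where open ≡-Reasoning

∸<-swap : ∀ {m c L} → c ≤ m → L ≤ m → m ∸ c < L → m ∸ L < c
∸<-swap {m} {c} {L} c≤m L≤m m∸c<L = +-cancelʳ-< L (m ∸ L) c (begin-strict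
  m ∸ L + L ≡⟨ m∸n+n≡m L≤m ⟩
  m         ≡⟨ m∸n+n≡m c≤m ⟨
  m ∸ c + c <⟨ +-monoˡ-< c m∸c<L ⟩
  L + c     ≡⟨ +-comm L c ⟩
  c + L     ∎)
  where open ≤-Reasoning

≥2-view : ∀ {x} → 2 ≤ x → ∃[ y ] x ≡ suc (suc y)
≥2-view {suc zero}    (s≤s ())
≥2-view {suc (suc y)} _ = y , refl

Cell-++ : ∀ (A : RowSpec) x B c → InRow x c → Cell (A ++ x ∷ B) (suc (length A)) c
Cell-++ []      x B c inRow = inRow
Cell-++ (_ ∷ A) x B c inRow = Cell-++ A x B c inRow

module Staircase (α λ′ : List ℕ) (k : ℕ) (T : Filling)
  (ssyt : IsSSYT (fatStaircase λ′ α k) T) (lat : IsLattice (readingWord (fatStaircase λ′ α k) T)) where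

  E : ℕ
  E = length α + k

  rowShape : ℕ → ℕ × ℕ
  rowShape L = (suc (E ∸ L) , L)

  rows : List ℕ
  rows = deltaLens 1 α

  foundation : RowSpec
  foundation = map (λ l → (1 , l)) λ′

  D : RowSpec
  D = fatStaircase λ′ α k

  W : List ℕ
  W = readingWord D T

  positive : ∀ r c → Cell D r c → 1 ≤ T r c
  positive = proj₁ ssyt

  rowWeak : ∀ r c c′ → Cell D r c → Cell D r c′ → c < c′ → T r c ≤ T r c′
  rowWeak = proj₁ (proj₂ ssyt)

  colStrict : ∀ r r′ c → Cell D r c → Cell D r′ c → r < r′ → T r c < T r′ c
  colStrict = proj₂ (proj₂ ssyt)

  -- the number of rows among Ls (right-aligned at column E) that contain column c
  height : List ℕ → ℕ → ℕ
  height Ls c = count≥ (suc (E ∸ c)) Ls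

  height-monotone : ∀ Ls c c′ → c′ ≤ c → height Ls c′ ≤ height Ls c
  height-monotone Ls c c′ c′≤c = count≥-antitone _ _ Ls (s≤s (∸-monoʳ-≤ E c′≤c))

  Content : (ℕ → ℕ) → List ℕ → Set
  Content g p = ∀ u → 1 ≤ u → occ u p ≡ columns≥ g u E

  Bottom : List ℕ → Set
  Bottom Ls = ∀ c → c ≤ E → 1 ≤ height Ls c → Cell D (length Ls) c × T (length Ls) c ≡ height Ls c

  module Row (Ls : List ℕ) (L : ℕ) (Ls′ : List ℕ) (rows≡ : rows ≡ Ls ++ L ∷ Ls′) (L≤E : L ≤ E)
    (bottom : Bottom Ls) where

    r s : ℕ
    r = suc (length Ls)
    s = suc (E ∸ L)

    H : ℕ → ℕ
    H = height Ls

    -- the heights once the columns c ≥ t of row r have been read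
    raise : ℕ → ℕ → ℕ
    raise t c = H c + indicator (t ≤? c)

    s+L≡1+E : s + L ≡ suc E
    s+L≡1+E = cong suc (m∸n+n≡m L≤E)

    cell : ∀ c → s ≤ c → c ≤ E → Cell D r c
    cell c s≤c c≤E = subst (λ z → Cell z r c) (sym D≡) (subst (λ z → Cell D′ (suc z) c) (length-map rowShape Ls)
        (Cell-++ (map rowShape Ls) (rowShape L) (map rowShape Ls′ ++ foundation) c
          (s≤c , s≤s (subst (c ≤_) (sym (m∸n+n≡m L≤E)) c≤E))))
      where
      D′ : RowSpec
      D′ = map rowShape Ls ++ rowShape L ∷ (map rowShape Ls′ ++ foundation)
      D≡ : D ≡ D′
      D≡ = trans (cong (λ z → map rowShape z ++ foundation) rows≡)
             (trans (cong (_++ foundation) (map-++ rowShape Ls (L ∷ Ls′))) (++-assoc (map rowShape Ls) _ foundation))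

    exceeds-height : ∀ c → s ≤ c → c ≤ E → suc (H c) ≤ T r c
    exceeds-height c s≤c c≤E with H c in Hc≡
    ... | zero  = positive r c (cell c s≤c c≤E)
    ... | suc h with bottom c c≤E (subst (1 ≤_) (sym Hc≡) (s≤s z≤n))
    ...   | cellAbove , T≡H = subst (_< T r c) (trans T≡H Hc≡) (colStrict (length Ls) r c cellAbove (cell c s≤c c≤E) ≤-refl)

    -- A larger entry x would need a column of height x - 1 among the current heights, but the
    -- columns to the right of c are at least x high and the others at most H c high.
    entry-forced : ∀ c p q → s ≤ c → c ≤ E → W ≡ p ++ T r c ∷ q → Content (raise (suc c)) p
      → (∀ c′ → suc c ≤ c′ → c′ ≤ E → T r c′ ≡ suc (H c′)) → T r c ≡ suc (H c)
    entry-forced c p q s≤c c≤E W≡ content right = ≤-antisym (≮⇒≥ excess-impossible) (exceeds-height c s≤c c≤E)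
      where
      excess-impossible : suc (H c) < T r c → ⊥
      excess-impossible big with ≥2-view (≤-trans (s≤s (s≤s z≤n)) big)
      ... | y , T≡ with columns≡-witness (raise (suc c)) (suc y) E
                         (lattice-predecessor lat p y q (subst (λ z → W ≡ p ++ z ∷ q) T≡ W≡) (raise (suc c)) E []
                           (λ u 1≤u → trans (content u 1≤u) (sym (+-identityʳ _))) refl)
      ...   | c′ , _ , c′≤E , g≡ with c′ ≤? c
      ...     | no c′≰c = 1+n≰n (begin
                  suc (suc y) ≡⟨ T≡ ⟨
                  T r c       ≤⟨ rowWeak r c c′ (cell c s≤c c≤E) (cell c′ (≤-trans s≤c (<⇒≤ c<c′)) c′≤E) c<c′ ⟩
                  T r c′      ≡⟨ right c′ c<c′ c′≤E ⟩
                  suc (H c′)  ≡⟨ +-comm 1 (H c′) ⟩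
                  H c′ + 1    ≡⟨ cong (H c′ +_) (indicator-yes (suc c ≤? c′) c<c′) ⟨
                  raise (suc c) c′ ≡⟨ g≡ ⟩
                  suc y       ∎)
        where
        open ≤-Reasoning
        c<c′ : c < c′
        c<c′ = ≰⇒> c′≰c
      ...     | yes c′≤c = 1+n≰n (begin
                  suc y       ≡⟨ g≡ ⟨
                  raise (suc c) c′ ≡⟨ cong (H c′ +_) (indicator-no (suc c ≤? c′) (<⇒≱ (s≤s c′≤c))) ⟩
                  H c′ + 0    ≡⟨ +-identityʳ _ ⟩
                  H c′        ≤⟨ height-monotone Ls c c′ c′≤c ⟩
                  H c         ≤⟨ s≤s⁻¹ (s≤s⁻¹ (subst (suc (suc (H c)) ≤_) T≡ big)) ⟩
                  y           ∎)
        where open ≤-Reasoning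

    content-snoc : ∀ c p → 1 ≤ c → c ≤ E → Content (raise (suc c)) p → T r c ≡ suc (H c)
      → Content (raise c) (p ++ [ T r c ])
    content-snoc c p 1≤c c≤E content T≡ u 1≤u = begin
      occ u (p ++ [ T r c ])                   ≡⟨ occ-snoc u p (T r c) ⟩
      occ u p + indicator (T r c ≟ u)
        ≡⟨ cong₂ _+_ (content u 1≤u) (cong (λ z → indicator (z ≟ u)) (trans T≡ (cong suc (sym raise-c)))) ⟩
      columns≥ (raise (suc c)) u E + indicator (suc (raise (suc c) c) ≟ u)
        ≡⟨ columns≥-grow (raise (suc c)) (raise c) u E c 1≤c c≤E grown others ⟨
      columns≥ (raise c) u E                   ∎
      where
      open ≡-Reasoning
      raise-c : raise (suc c) c ≡ H c
      raise-c = trans (cong (H c +_) (indicator-no (suc c ≤? c) (n≮n c))) (+-identityʳ _)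
      grown : raise c c ≡ suc (raise (suc c) c)
      grown = trans (cong (H c +_) (indicator-yes (c ≤? c) ≤-refl)) (trans (+-comm (H c) 1) (cong suc (sym raise-c)))
      others : ∀ c′ → c′ ≢ c → raise c c′ ≡ raise (suc c) c′
      others c′ c′≢c = cong (H c′ +_) (indicator-cong (λ c≤c′ → ≤∧≢⇒< c≤c′ (c′≢c ∘ sym)) <⇒≤ (c ≤? c′) (suc c ≤? c′))

    RowRead : ℕ → List ℕ → Set
    RowRead t p = Content (raise t) p × (∀ c → t ≤ c → c ≤ E → T r c ≡ suc (H c))

    row-forced : ∀ l → s + l ≤ suc E → ∀ p Z → W ≡ p ++ map (T r) (reverse (upFrom s l)) ++ Z → RowRead (s + l) p
      → ∃[ p′ ] (W ≡ p′ ++ Z × RowRead s p′)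
    row-forced zero    _     p Z W≡ read = p , W≡ , subst (λ t → RowRead t p) (+-identityʳ s) read
    row-forced (suc l) bound p Z W≡ (content , right) =
      row-forced l (≤-trans (n≤1+n _) bound′) (p ++ [ T r c ]) Z W≡′ (content′ , right′)
      where
      c : ℕ
      c = s + l
      rest : List ℕ
      rest = map (T r) (reverse (upFrom s l)) ++ Z
      bound′ : suc c ≤ suc E
      bound′ = subst (_≤ suc E) (+-suc s l) bound
      c≤E : c ≤ E
      c≤E = s≤s⁻¹ bound′
      W≡₁ : W ≡ p ++ T r c ∷ rest
      W≡₁ = trans W≡ (cong (λ z → p ++ map (T r) z ++ Z) (reverse-upFrom-suc s l))
      W≡′ : W ≡ (p ++ [ T r c ]) ++ rest
      W≡′ = trans W≡₁ (sym (++-assoc p [ T r c ] rest))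
      forced : T r c ≡ suc (H c)
      forced = entry-forced c p rest (m≤m+n s l) c≤E W≡₁ (subst (λ t → Content (raise t) p) (+-suc s l) content)
        (λ c′ c<c′ → right c′ (subst (_≤ c′) (sym (+-suc s l)) c<c′))
      content′ : Content (raise c) (p ++ [ T r c ])
      content′ = content-snoc c p (≤-trans (s≤s z≤n) (m≤m+n s l)) c≤E (subst (λ t → Content (raise t) p) (+-suc s l) content) forced
      right′ : ∀ c′ → c ≤ c′ → c′ ≤ E → T r c′ ≡ suc (H c′)
      right′ c′ c≤c′ c′≤E with c′ ≟ c
      ... | yes refl = forced
      ... | no  c′≢c = right c′ (subst (_≤ c′) (sym (+-suc s l)) (≤∧≢⇒< c≤c′ (c′≢c ∘ sym))) c′≤E

    height-snoc : ∀ c → height (Ls ++ [ L ]) c ≡ H c + indicator (suc (E ∸ c) ≤? L)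
    height-snoc c = trans (count≥-++ _ Ls [ L ]) (cong (H c +_) (+-identityʳ _))

    covers : ∀ c → c ≤ E → suc (E ∸ c) ≤ L → s ≤ c
    covers c c≤E = ∸<-swap c≤E L≤E

    raise≡height : ∀ c → c ≤ E → raise s c ≡ height (Ls ++ [ L ]) c
    raise≡height c c≤E = trans (cong (H c +_) (indicator-cong (∸<-swap L≤E c≤E) (covers c c≤E) (s ≤? c) _)) (sym (height-snoc c))

    row-complete : ∀ p → W ≡ p ++ readFrom T r (map rowShape (L ∷ Ls′) ++ foundation) → Content H p
      → ∃[ p′ ] (W ≡ p′ ++ readFrom T (suc r) (map rowShape Ls′ ++ foundation)
                 × Content (height (Ls ++ [ L ])) p′ × (∀ c → s ≤ c → c ≤ E → T r c ≡ height (Ls ++ [ L ]) c))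
    row-complete p W≡ content with row-forced L (≤-reflexive s+L≡1+E) p Z W≡₀ (content₀ , right₀)
      where
      Z : List ℕ
      Z = readFrom T (suc r) (map rowShape Ls′ ++ foundation)
      W≡₀ : W ≡ p ++ map (T r) (reverse (upFrom s L)) ++ Z
      W≡₀ = trans W≡ (cong (λ z → p ++ map (T r) (reverse z) ++ Z) (range≡upFrom s L))
      beyond : ∀ c → s + L ≤ c → c ≤ E → ⊥
      beyond c s+L≤c c≤E = 1+n≰n (≤-trans (subst (_≤ c) s+L≡1+E s+L≤c) c≤E)
      content₀ : Content (raise (s + L)) p
      content₀ u 1≤u = trans (content u 1≤u) (columns≥-cong H (raise (s + L)) u E
        (λ c _ c≤E → sym (trans (cong (H c +_) (indicator-no (s + L ≤? c) (λ s+L≤c → beyond c s+L≤c c≤E))) (+-identityʳ _))))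
      right₀ : ∀ c → s + L ≤ c → c ≤ E → T r c ≡ suc (H c)
      right₀ c s+L≤c c≤E = ⊥-elim (beyond c s+L≤c c≤E)
    ... | p′ , W≡′ , content′ , right′ =
      p′ , W≡′ ,
      (λ u 1≤u → trans (content′ u 1≤u) (columns≥-cong _ _ u E (λ c _ c≤E → raise≡height c c≤E))) ,
      (λ c s≤c c≤E → trans (right′ c s≤c c≤E)
         (trans (trans (+-comm 1 (H c)) (sym (cong (H c +_) (indicator-yes (s ≤? c) s≤c)))) (raise≡height c c≤E)))

  Covered : ℕ → List ℕ → Set
  Covered L₀ Ls = ∀ c → c ≤ E → 1 ≤ height Ls c → suc (E ∸ L₀) ≤ c

  record StaircaseRead (Ls : List ℕ) : Set where
    field
      prefix         : List ℕ
      prefix-read    : W ≡ prefix ++ readFrom T (suc (length Ls)) foundation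
      prefix-content : Content (height Ls) prefix
      bottom         : Bottom Ls

  rows-forced : ∀ Ls Ls′ → rows ≡ Ls ++ Ls′ → ∀ L₀ → Linked _≤_ (L₀ ∷ Ls′) → All (_≤ E) Ls′
    → ∀ p → W ≡ p ++ readFrom T (suc (length Ls)) (map rowShape Ls′ ++ foundation)
    → Content (height Ls) p → Covered L₀ Ls → Bottom Ls → StaircaseRead rows
  rows-forced Ls [] rows≡ _ _ _ p W≡ content _ bottom =
    subst StaircaseRead (sym (trans rows≡ (++-identityʳ Ls)))
      (record { prefix = p ; prefix-read = W≡ ; prefix-content = content ; bottom = bottom })
  rows-forced Ls (L ∷ Ls′) rows≡ L₀ (L₀≤L ∷ sorted) (L≤E ∷ bounded) p W≡ content covered bottom
    with Row.row-complete Ls L Ls′ rows≡ L≤E bottom p W≡ content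
  ... | p′ , W≡′ , content′ , row≡ =
    rows-forced (Ls ++ [ L ]) Ls′ (trans rows≡ (sym (++-assoc Ls [ L ] Ls′))) L sorted bounded p′
      (subst (λ z → W ≡ p′ ++ readFrom T (suc z) (map rowShape Ls′ ++ foundation)) (sym length-snoc) W≡′)
      content′ covered′ bottom′
    where
    open Row Ls L Ls′ rows≡ L≤E bottom using (s; H; height-snoc; covers; cell)
    length-snoc : length (Ls ++ [ L ]) ≡ suc (length Ls)
    length-snoc = trans (length-++ Ls) (+-comm (length Ls) 1)
    covered′ : Covered L (Ls ++ [ L ])
    covered′ c c≤E positive′ with suc (E ∸ c) ≤? L
    ... | yes covers-c = covers c c≤E covers-c
    ... | no  misses-c = ≤-trans (s≤s (∸-monoʳ-≤ E L₀≤L)) (covered c c≤E (subst (1 ≤_) unchanged positive′))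
      where
      unchanged : height (Ls ++ [ L ]) c ≡ H c
      unchanged = trans (height-snoc c) (trans (cong (H c +_) (indicator-no (suc (E ∸ c) ≤? L) misses-c)) (+-identityʳ _))
    bottom′ : Bottom (Ls ++ [ L ])
    bottom′ c c≤E positive′ = subst (λ z → Cell D z c × T z c ≡ height (Ls ++ [ L ]) c) (sym length-snoc)
      (cell c s≤c c≤E , row≡ c s≤c c≤E)
      where
      s≤c : s ≤ c
      s≤c = covered′ c c≤E positive′

  staircase-forced : StaircaseRead rows
  staircase-forced = rows-forced [] rows refl 0 (deltaLens-sorted 0 1 α z≤n)
    (All.map (λ L<1+n → ≤-trans (s≤s⁻¹ L<1+n) (m≤m+n (length α) k)) (deltaLens-bounded 1 α))
    [] refl (λ u 1≤u → sym (columns≥-zero-heights u E 1≤u)) (λ _ _ ()) (λ _ _ ())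

module Foundation (α : List ℕ) (λ₁ : ℕ) (λs : List ℕ) (k : ℕ) (T : Filling) (comp : IsComposition α)
  (ssyt : IsSSYT (fatStaircase (λ₁ ∷ λs) α k) T) (lat : IsLattice (readingWord (fatStaircase (λ₁ ∷ λs) α k) T))
  (λ₁≤E : λ₁ ≤ length α + k) where

  open Staircase α (λ₁ ∷ λs) k T ssyt lat

  n : ℕ
  n = length α

  HΔ : ℕ → ℕ
  HΔ = height rows

  HΔ≡ : ∀ c → HΔ c ≡ sum (drop (E ∸ c) α)
  HΔ≡ c = count≥-deltaLens 1 (E ∸ c) α

  HΔ-positive : ∀ c → k < c → c ≤ E → 1 ≤ HΔ c
  HΔ-positive c k<c c≤E = subst (1 ≤_) (sym (HΔ≡ c)) (≤-trans (s≤s z≤n) (sum-drop-suc< α (E ∸ c) comp E∸c<n))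
    where
    E∸c<n : E ∸ c < n
    E∸c<n = ∸<-swap (m≤m+n n k) c≤E (subst (_< c) (sym (m+n∸m≡n n k)) k<c)

  HΔ-strict : ∀ c c′ → c < c′ → c′ ≤ E → 1 ≤ HΔ c → HΔ c < HΔ c′
  HΔ-strict c c′ c<c′ c′≤E positive = subst₂ _<_ (sym (HΔ≡ c)) (sym (HΔ≡ c′))
    (<-≤-trans (s≤s (sum-drop-antitone α (suc (E ∸ c′)) (E ∸ c) d′<d))
               (sum-drop-suc< α (E ∸ c′) comp (<-trans d′<d (sum-drop-positive⇒< α (E ∸ c) (subst (1 ≤_) (HΔ≡ c) positive)))))
    where
    d′<d : E ∸ c′ < E ∸ c
    d′<d = ∸-monoʳ-< c<c′ c′≤E

  HΔ-injective : ∀ v → 1 ≤ v → ∀ c c′ → 1 ≤ c → c ≤ E → 1 ≤ c′ → c′ ≤ E → HΔ c ≡ v → HΔ c′ ≡ v → c ≡ c′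
  HΔ-injective v 1≤v c c′ _ c≤E _ c′≤E Hc≡v Hc′≡v with <-cmp c c′
  ... | tri< c<c′ _ _ = ⊥-elim (<⇒≢ (HΔ-strict c c′ c<c′ c′≤E (subst (1 ≤_) (sym Hc≡v) 1≤v)) (trans Hc≡v (sym Hc′≡v)))
  ... | tri≈ _ c≡c′ _ = c≡c′
  ... | tri> _ _ c′<c = ⊥-elim (<⇒≢ (HΔ-strict c′ c c′<c c≤E (subst (1 ≤_) (sym Hc′≡v) 1≤v)) (trans Hc′≡v (sym Hc≡v)))

  HΔ-partial-sum : ∀ c → 1 ≤ HΔ c → ∃[ j ] (1 ≤ j × j ≤ n × HΔ c ≡ sum (take j (reverse α)))
  HΔ-partial-sum c positive = n ∸ d , m<n⇒0<n∸m d<n , m∸n≤m n d , (begin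
    HΔ c                                ≡⟨ HΔ≡ c ⟩
    sum (drop d α)                      ≡⟨ cong (λ z → sum (drop z α)) (m∸[m∸n]≡n (<⇒≤ d<n)) ⟨
    sum (drop (n ∸ (n ∸ d)) α)          ≡⟨ sum-take-reverse α (n ∸ d) (m∸n≤m n d) ⟨
    sum (take (n ∸ d) (reverse α))      ∎)
    where
    open ≡-Reasoning
    d : ℕ
    d = E ∸ c
    d<n : d < n
    d<n = sum-drop-positive⇒< α d (subst (1 ≤_) (HΔ≡ c) positive)

  R : ℕ
  R = suc (sum α)

  length-rows : length rows ≡ sum α
  length-rows = length-deltaLens 1 α

  cellR : ∀ c → 1 ≤ c → c ≤ λ₁ → Cell D R c
  cellR c 1≤c c≤λ₁ = subst (λ z → Cell D (suc z) c) (trans (length-map rowShape rows) length-rows)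
    (Cell-++ (map rowShape rows) (1 , λ₁) (map (λ l → (1 , l)) λs) c (1≤c , s≤s c≤λ₁))

  open StaircaseRead staircase-forced renaming (prefix to pΔ; prefix-content to contentΔ)

  W≡pΔ++ : W ≡ pΔ ++ map (T R) (reverse (upFrom 1 λ₁)) ++ readFrom T (suc R) (map (λ l → (1 , l)) λs)
  W≡pΔ++ = trans prefix-read
    (trans (cong (λ z → pΔ ++ readFrom T (suc z) foundation) length-rows)
           (cong (λ z → pΔ ++ map (T R) (reverse z) ++ readFrom T (suc R) (map (λ l → (1 , l)) λs)) (range≡upFrom 1 λ₁)))

  bottomΔ : ∀ c → c ≤ E → 1 ≤ HΔ c → Cell D (sum α) c × T (sum α) c ≡ HΔ c
  bottomΔ c c≤E positive = subst (λ z → Cell D z c × T z c ≡ HΔ c) length-rows (bottom c c≤E positive)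

  beyond-k : ∀ c → k < c → c ≤ λ₁ → 2 ≤ T R c
  beyond-k c k<c c≤λ₁ = ≤-trans (s≤s (subst (1 ≤_) (sym (proj₂ below)) positiveΔ))
    (colStrict (sum α) R c (proj₁ below) (cellR c (≤-trans (s≤s z≤n) k<c) c≤λ₁) ≤-refl)
    where
    positiveΔ : 1 ≤ HΔ c
    positiveΔ = HΔ-positive c k<c (≤-trans c≤λ₁ λ₁≤E)
    below : Cell D (sum α) c × T (sum α) c ≡ HΔ c
    below = bottomΔ c (≤-trans c≤λ₁ λ₁≤E) positiveΔ

  one⇒≤k : ∀ c → c ≤ λ₁ → T R c ≡ 1 → c ≤ k
  one⇒≤k c c≤λ₁ T≡1 with k <? c
  ... | yes k<c = ⊥-elim (1+n≰n (subst (2 ≤_) T≡1 (beyond-k c k<c c≤λ₁)))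
  ... | no  k≮c = ≮⇒≥ k≮c

  successor-of-height-in-R : ∀ y → 1 ≤ columns≡ HΔ (suc y) E → InR α k (suc (suc y))
  successor-of-height-in-R y present with columns≡-witness HΔ (suc y) E present
  ... | c′ , _ , _ , HΔc′≡ with HΔ-partial-sum c′ (subst (1 ≤_) (sym HΔc′≡) (s≤s z≤n))
  ...   | j , 1≤j , j≤n , HΔ≡sum = inj₁ (j , 1≤j , j≤n , cong suc (trans (sym HΔc′≡) HΔ≡sum))

  entry-in-R : ∀ c p q seg → 1 ≤ c → c ≤ λ₁ → W ≡ p ++ T R c ∷ q
    → (∀ u → 1 ≤ u → occ u p ≡ columns≥ HΔ u E + occ u seg) → All (T R c ≤_) seg
    → InR α k (T R c) × (T R c ≢ 1 → occ (T R c) seg ≡ 0)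
  entry-in-R c p q seg 1≤c c≤λ₁ W≡ content seg≥ with T R c ≟ 1
  ... | yes T≡1 = inj₂ (≤-trans 1≤c (one⇒≤k c c≤λ₁ T≡1) , T≡1) , (λ T≢1 → ⊥-elim (T≢1 T≡1))
  ... | no  T≢1 with ≥2-view (≤∧≢⇒< (positive R c (cellR c 1≤c c≤λ₁)) (T≢1 ∘ sym))
  ...   | y , T≡ = subst (InR α k) (sym T≡) (successor-of-height-in-R y (≤-trans (s≤s z≤n) excess)) ,
                   (λ _ → subst (λ z → occ z seg ≡ 0) (sym T≡) (n≤0⇒n≡0 (s≤s⁻¹ (≤-trans excess unique))))
    where
    free : occ (suc y) seg ≡ 0
    free = occ-absent (suc y) seg (All.map (λ T≤z z≡ → 1+n≰n (subst (_≤ suc y) T≡ (subst (T R c ≤_) z≡ T≤z))) seg≥)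
    excess : suc (occ (suc (suc y)) seg) ≤ columns≡ HΔ (suc y) E
    excess = lattice-predecessor lat p y q (subst (λ z → W ≡ p ++ z ∷ q) T≡ W≡) HΔ E seg content free
    unique : columns≡ HΔ (suc y) E ≤ 1
    unique = columns≡-atMostOne HΔ (suc y) E (HΔ-injective (suc y) (s≤s z≤n))

  foundation-read : ∀ l d → l + d ≡ λ₁ → ∀ p Z → W ≡ p ++ map (T R) (reverse (upFrom 1 l)) ++ Z
    → (∀ u → 1 ≤ u → occ u p ≡ columns≥ HΔ u E + occ u (map (T R) (upFrom (suc l) d)))
    → (∀ v → v ≢ 1 → occ v (map (T R) (upFrom (suc l) d)) ≤ 1)
    → (∀ c → suc l ≤ c → c ≤ λ₁ → InR α k (T R c))
    → (∀ v → v ≢ 1 → occ v (map (T R) (upFrom 1 λ₁)) ≤ 1) × (∀ c → 1 ≤ c → c ≤ λ₁ → InR α k (T R c))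
  foundation-read zero    d refl  p Z W≡ content distinct inR = distinct , inR
  foundation-read (suc l) d l+d≡ p Z W≡ content distinct inR =
    foundation-read l (suc d) (trans (+-suc l d) l+d≡) (p ++ [ x ]) Z W≡′ content′ distinct′ inR′
    where
    c x : ℕ
    c = suc l
    x = T R c
    seg rest : List ℕ
    seg = map (T R) (upFrom (suc c) d)
    rest = map (T R) (reverse (upFrom 1 l)) ++ Z
    c≤λ₁ : c ≤ λ₁
    c≤λ₁ = subst (c ≤_) l+d≡ (m≤m+n c d)
    W≡₁ : W ≡ p ++ x ∷ rest
    W≡₁ = trans W≡ (cong (λ z → p ++ map (T R) z ++ Z) (reverse-upFrom-suc 1 l))
    W≡′ : W ≡ (p ++ [ x ]) ++ rest
    W≡′ = trans W≡₁ (sym (++-assoc p [ x ] rest))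
    seg≥ : All (x ≤_) seg
    seg≥ = map⁺ (All-upFrom (suc c) d (λ c′ c<c′ c′<1+c+d →
      rowWeak R c c′ (cellR c (s≤s z≤n) c≤λ₁)
        (cellR c′ (≤-trans (s≤s z≤n) c<c′) (s≤s⁻¹ (subst (c′ <_) (cong suc l+d≡) c′<1+c+d))) c<c′))
    entry : InR α k x × (x ≢ 1 → occ x seg ≡ 0)
    entry = entry-in-R c p rest seg (s≤s z≤n) c≤λ₁ W≡₁ content seg≥
    content′ : ∀ u → 1 ≤ u → occ u (p ++ [ x ]) ≡ columns≥ HΔ u E + occ u (x ∷ seg)
    content′ u 1≤u = occ-snoc-shift u p x (columns≥ HΔ u E) seg (content u 1≤u)
    distinct′ : ∀ v → v ≢ 1 → occ v (x ∷ seg) ≤ 1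
    distinct′ = occ-∷-atMostOnce 1 x seg distinct (proj₂ entry)
    inR′ : ∀ c′ → c ≤ c′ → c′ ≤ λ₁ → InR α k (T R c′)
    inR′ c′ c≤c′ c′≤λ₁ with c′ ≟ c
    ... | yes refl = proj₁ entry
    ... | no  c′≢c = inR c′ (≤∧≢⇒< c≤c′ (c′≢c ∘ sym)) c′≤λ₁

  foundation-row : (∀ c → 1 ≤ c → c ≤ λ₁ → InR α k (T R c))
    × occ 1 (map (T R) (range 1 λ₁)) ≤ k
    × (∀ v → v ≢ 1 → occ v (map (T R) (range 1 λ₁)) ≤ 1)
  foundation-row =
    proj₂ read ,
    subst (λ z → occ 1 (map (T R) z) ≤ k) (sym (range≡upFrom 1 λ₁)) (occ-map-upFrom≤ (T R) 1 k λ₁ one⇒≤k) ,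
    (λ v v≢1 → subst (λ z → occ v (map (T R) z) ≤ 1) (sym (range≡upFrom 1 λ₁)) (proj₁ read v v≢1))
    where
    read : (∀ v → v ≢ 1 → occ v (map (T R) (upFrom 1 λ₁)) ≤ 1) × (∀ c → 1 ≤ c → c ≤ λ₁ → InR α k (T R c))
    read = foundation-read λ₁ 0 (+-identityʳ λ₁) pΔ _ W≡pΔ++ (λ u 1≤u → trans (contentΔ u 1≤u) (sym (+-identityʳ _)))
      (λ _ _ → z≤n) (λ c λ₁<c c≤λ₁ → ⊥-elim (1+n≰n (≤-trans λ₁<c c≤λ₁)))

lemma1 : (α λ' : List ℕ) (k : ℕ) (T : Filling)
    → IsComposition α → IsPartition λ'
    → part1 λ' ∸ k ≤ length α
    → IsSSYT (fatStaircase λ' α k) T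
    → IsLattice (readingWord (fatStaircase λ' α k) T)
    → (∀ c → 1 ≤ c → c ≤ part1 λ' → InR α k (T (suc (sum α)) c))
      × (occ 1 (map (T (suc (sum α))) (range 1 (part1 λ'))) ≤ k)
      × (∀ v → ¬ (v ≡ 1) → occ v (map (T (suc (sum α))) (range 1 (part1 λ'))) ≤ 1)
-- Only the first row of the foundation is involved, so λ' need not be a partition.
lemma1 α []         k T _    _ _     _    _   = (λ c 1≤c c≤0 → ⊥-elim (1+n≰n (≤-trans 1≤c c≤0))) , z≤n , (λ _ _ → z≤n)
lemma1 α (λ₁ ∷ λs) k T comp _ bound ssyt lat =
  Foundation.foundation-row α λ₁ λs k T comp ssyt lat
    (subst (λ₁ ≤_) (+-comm k (length α)) (≤-trans (m≤n+m∸n λ₁ k) (+-monoʳ-≤ k bound)))
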